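{- Let $G$ be a chordal graph, let $\mathcal{T}$ be a compact clique tree (compact tree decomposition in which every bag is a clique) of $G$ of width at most $\omega$, and let $I$ be an independent set of $G$ of size $k$. Then there exists an independent set $I'$ of $G$ and a token sliding transformation from $I$ to $I'$ such that each vertex of $I'$ belongs to at most $(3\omega+3)k^2$ bags of $\mathcal{T}$.
   Context: A tree decomposition of $G$ is a pair $(T,\chi)$ with $T$ a tree and $\chi$ assigning to each node a bag $B_i\subseteq V(G)$ such that the bags cover $V(G)$, every edge lies in some bag, and the nodes whose bag contains a given vertex form a subtree; its width is the maximum bag size minus one. It is compact if for any two adjacent nodes neither bag is contained in the other. A graph is chordal iff it has a compact tree decomposition all of whose bags are cliques (a clique tree). A token sliding transformation from $I$ to $I'$ is a sequence of independent sets of $G$ from $I$ to $I'$, each obtained from the previous one by moving one token from a vertex $u$ to a neighbor $v$ of $u$. -}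

module Defs where

open import Data.Nat using (ℕ; zero; suc; _+_; _*_; _≤_)
open import Data.Fin using (Fin; toℕ)
open import Data.Fin.Subset using (Subset; _∈_; _∉_; _⊆_; ∣_∣; inside; outside)
open import Data.Vec using (tabulate; lookup; _[_]≔_)
open import Data.Product using (Σ; ∃; ∃-syntax; _×_; _,_)
open import Data.Sum using (_⊎_)
open import Relation.Nullary using (¬_; Dec)
open import Relation.Binary.PropositionalEquality using (_≡_; _≢_)
open import Function.Definitions using (Injective)

record Graph : Set₁ where
  field
    n      : ℕ
    Adj    : Fin n → Fin n → Set
    sym    : ∀ {u v} → Adj u v → Adj v u
    irrefl : ∀ {u} → ¬ Adj u u
    dec    : ∀ u v → Dec (Adj u v)
open Graph public

CycNext : (l : ℕ) → Fin l → Fin l → Set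
CycNext l i j = (suc (toℕ i) ≡ toℕ j) ⊎ ((suc (toℕ i) ≡ l) × (toℕ j ≡ 0))

record Cycle (G : Graph) : Set where
  field
    len   : ℕ
    len≥3 : 3 ≤ len
    vert  : Fin len → Fin (n G)
    inj   : Injective _≡_ _≡_ vert
    edges : ∀ i j → CycNext len i j → Adj G (vert i) (vert j)
open Cycle public

Chordal : Graph → Set
Chordal G = (C : Cycle G) → 4 ≤ len C →
  ∃[ i ] ∃[ j ] (i ≢ j × ¬ CycNext (len C) i j × ¬ CycNext (len C) j i
                 × Adj G (vert C i) (vert C j))

data WalkIn (G : Graph) (P : Fin (n G) → Set) : Fin (n G) → Fin (n G) → Set where
  here : ∀ {x} → P x → WalkIn G P x x
  step : ∀ {x y z} → P x → Adj G x y → WalkIn G P y z → WalkIn G P x z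


Connected : Graph → Set
Connected G = ∀ x y → WalkIn G (λ _ → Data.Unit.⊤) x y
  where import Data.Unit

IsTree : Graph → Set
IsTree T = Connected T × ¬ Cycle T

record TreeDecomposition (G : Graph) : Set₁ where
  field
    T       : Graph
    isTree  : IsTree T
    bag     : Fin (n T) → Subset (n G)
    cover   : ∀ v → ∃[ t ] (v ∈ bag t)
    edgeCov : ∀ u v → Adj G u v → ∃[ t ] (u ∈ bag t × v ∈ bag t)
    subtree : ∀ v t t' → v ∈ bag t → v ∈ bag t' → WalkIn T (λ s → v ∈ bag s) t t'
open TreeDecomposition public

WidthAtMost : ∀ {G} → TreeDecomposition G → ℕ → Set
WidthAtMost D ω = ∀ t → ∣ bag D t ∣ ≤ suc ω

Compact : ∀ {G} → TreeDecomposition G → Set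
Compact D = ∀ t t' → Adj (T D) t t' → ¬ (bag D t ⊆ bag D t')

IsClique : (G : Graph) → Subset (n G) → Set
IsClique G B = ∀ u v → u ∈ B → v ∈ B → u ≢ v → Adj G u v

IsCliqueTree : ∀ {G} → TreeDecomposition G → Set
IsCliqueTree {G} D = Compact D × (∀ t → IsClique G (bag D t))

Independent : (G : Graph) → Subset (n G) → Set
Independent G I = ∀ u v → u ∈ I → v ∈ I → ¬ Adj G u v

Slide : (G : Graph) → Subset (n G) → Subset (n G) → Set
Slide G I J = ∃[ u ] ∃[ v ] (Adj G u v × u ∈ I × v ∉ I
                             × J ≡ ((I [ u ]≔ outside) [ v ]≔ inside))

data TokenSliding (G : Graph) : Subset (n G) → Subset (n G) → Set where
  done : ∀ {I} → TokenSliding G I I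
  move : ∀ {I J K} → Slide G I J → Independent G J → TokenSliding G J K → TokenSliding G I K

bagsOf : ∀ {G} → (D : TreeDecomposition G) → Fin (n G) → Subset (n (T D))
bagsOf D v = tabulate (λ t → lookup (bag D t) v)

-- Root the clique tree and let top x be the highest node whose bag contains x. By compactness
-- every non-root node c has a vertex w_c in its bag but not in its parent's, and then top w_c = c.
-- As long as some token v lies in a bag c ≠ top v such that no other token is adjacent to w_c,
-- slide v to w_c (bags are cliques); this moves the top of that token strictly deeper, so the
-- process terminates. Afterwards each such w_c is adjacent to a token u, which forces w_c into
-- the bag of the parent of top u; as c ↦ w_c is injective, v lies in at most k (ω + 1) + 1 bags.
module Submission where

open import Defs hiding (sym)
open import Data.Empty using (⊥; ⊥-elim)
open import Data.Fin.Base using (Fin; zero; suc; toℕ)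
open import Data.Fin.Properties using (any?; toℕ-injective; toℕ<n) renaming (_≟_ to _≟ᶠ_; suc-injective to sucᶠ-injective; 0≢1+n to 0ᶠ≢1+n)
open import Data.Fin.Subset using (Subset; _∈_; _∉_; _⊆_; ∣_∣; inside; outside; _∪_; ⁅_⁆) renaming (⊥ to ∅)
open import Data.Fin.Subset.Properties using (_∈?_; x∈p∪q⁺; x∈⁅x⁆; ∣⁅x⁆∣≡1; ∣⊥∣≡0)
open import Data.Nat.Base using (ℕ; zero; suc; pred; _+_; _*_; _∸_; _≤_; _<_; _⊔_; z≤n; s≤s; z<s; >-nonZero)
open import Data.Nat.Induction using (<-wellFounded)
open import Data.Nat.Properties
open import Data.Product using (Σ; ∃-syntax; _×_; _,_; proj₁; proj₂)
open import Data.Sum using (_⊎_; inj₁; inj₂)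
open import Data.Vec.Base using ([]; _∷_; here; there; lookup; _[_]=_; _[_]≔_)
open import Data.Vec.Properties
  using ([]=-injective; lookup⇒[]=; []=⇒lookup; []≔-updates; []≔-minimal; lookup∘tabulate)
open import Function.Base using (_∘_)
open import Induction.WellFounded using (Acc; acc)
open import Relation.Binary.PropositionalEquality
  using (_≡_; _≢_; refl; sym; trans; cong; subst; subst₂; module ≡-Reasoning)
open import Relation.Nullary using (¬_; Dec; yes; no; ¬?)
open import Relation.Nullary.Decidable using (_×-dec_; decidable-stable)

private variable m m′ : ℕ

leastWitness : (P : ℕ → Set) → (∀ k → Dec (P k)) → ∀ k → P k →
               Σ ℕ λ j → P j × (∀ i → i < j → ¬ P i)
leastWitness P P? zero p = 0 , p , λ _ ()
leastWitness P P? (suc k) p with P? 0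
... | yes p₀ = 0 , p₀ , λ _ ()
... | no ¬p₀ with leastWitness (P ∘ suc) (P? ∘ suc) k p
...   | j , pj , below = suc j , pj , λ where
          zero    _         → ¬p₀
          (suc i) (s≤s i<j) → below i i<j

max : (Fin m → ℕ) → ℕ
max {zero}  f = 0
max {suc m} f = f zero ⊔ max (f ∘ suc)

≤-max : ∀ (f : Fin m → ℕ) i → f i ≤ max f
≤-max f zero    = m≤m⊔n _ _
≤-max f (suc i) = ≤-trans (≤-max (f ∘ suc) i) (m≤n⊔m _ _)

Fin-inhabited? : ∀ m → Dec (Fin m)
Fin-inhabited? zero    = no λ ()
Fin-inhabited? (suc m) = yes zero

-- Finite subsets

∉-[]≔outside : ∀ (p : Subset m) x → x ∉ p [ x ]≔ outside
∉-[]≔outside p x x∈ with []=-injective x∈ ([]≔-updates p x)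
... | ()

∈-[]≔⁻ : ∀ (p : Subset m) {x y} s → y ≢ x → y ∈ p [ x ]≔ s → y ∈ p
∈-[]≔⁻ p {x} {y} s y≢x y∈ =
  subst (p [ y ]=_) ([]=-injective ([]≔-minimal p y x y≢x p[y]) y∈) p[y]
  where p[y] = lookup⇒[]= y p refl

sumOver : Subset m → (Fin m → ℕ) → ℕ
sumOver []            h = 0
sumOver (inside  ∷ p) h = h zero + sumOver p (h ∘ suc)
sumOver (outside ∷ p) h = sumOver p (h ∘ suc)

sumOver-remove : ∀ (p : Subset m) h {x} → x ∈ p → sumOver (p [ x ]≔ outside) h + h x ≡ sumOver p h
sumOver-remove (inside ∷ p) h {zero} _ = +-comm _ (h zero)
sumOver-remove (inside ∷ p) h {suc x} (there x∈p) =
  trans (+-assoc (h zero) _ _) (cong (h zero +_) (sumOver-remove p (h ∘ suc) x∈p))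
sumOver-remove (outside ∷ p) h {suc x} (there x∈p) = sumOver-remove p (h ∘ suc) x∈p

sumOver-insert : ∀ (p : Subset m) h {x} → x ∉ p → sumOver (p [ x ]≔ inside) h ≡ h x + sumOver p h
sumOver-insert (inside  ∷ p) h {zero} x∉p = ⊥-elim (x∉p here)
sumOver-insert (outside ∷ p) h {zero} _   = refl
sumOver-insert (inside  ∷ p) h {suc x} x∉p = begin
  h zero + sumOver (p [ x ]≔ inside) (h ∘ suc)  ≡⟨ cong (h zero +_) (sumOver-insert p (h ∘ suc) (x∉p ∘ there)) ⟩
  h zero + (h (suc x) + sumOver p (h ∘ suc))    ≡⟨ +-comm (h zero) _ ⟩
  (h (suc x) + sumOver p (h ∘ suc)) + h zero    ≡⟨ +-assoc (h (suc x)) _ _ ⟩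
  h (suc x) + (sumOver p (h ∘ suc) + h zero)    ≡⟨ cong (h (suc x) +_) (+-comm _ (h zero)) ⟩
  h (suc x) + (h zero + sumOver p (h ∘ suc))    ∎
  where open ≡-Reasoning
sumOver-insert (outside ∷ p) h {suc x} x∉p = sumOver-insert p (h ∘ suc) (x∉p ∘ there)

∣p∣≡sumOver-1 : ∀ (p : Subset m) → ∣ p ∣ ≡ sumOver p (λ _ → 1)
∣p∣≡sumOver-1 []            = refl
∣p∣≡sumOver-1 (inside  ∷ p) = cong suc (∣p∣≡sumOver-1 p)
∣p∣≡sumOver-1 (outside ∷ p) = ∣p∣≡sumOver-1 p

∣p∣≡1+∣p-x∣ : ∀ (p : Subset m) {x} → x ∈ p → ∣ p ∣ ≡ suc ∣ p [ x ]≔ outside ∣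
∣p∣≡1+∣p-x∣ p {x} x∈p = begin
  ∣ p ∣                                       ≡⟨ ∣p∣≡sumOver-1 p ⟩
  sumOver p (λ _ → 1)                         ≡⟨ sumOver-remove p _ x∈p ⟨
  sumOver (p [ x ]≔ outside) (λ _ → 1) + 1    ≡⟨ +-comm _ 1 ⟩
  suc (sumOver (p [ x ]≔ outside) (λ _ → 1))  ≡⟨ cong suc (∣p∣≡sumOver-1 (p [ x ]≔ outside)) ⟨
  suc ∣ p [ x ]≔ outside ∣                    ∎
  where open ≡-Reasoning

∣p+x∣≡1+∣p∣ : ∀ (p : Subset m) {x} → x ∉ p → ∣ p [ x ]≔ inside ∣ ≡ suc ∣ p ∣
∣p+x∣≡1+∣p∣ p {x} x∉p = trans (∣p∣≡sumOver-1 (p [ x ]≔ inside))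
  (trans (sumOver-insert p _ x∉p) (cong suc (sym (∣p∣≡sumOver-1 p))))

∣p∪q∣≤∣p∣+∣q∣ : ∀ (p q : Subset m) → ∣ p ∪ q ∣ ≤ ∣ p ∣ + ∣ q ∣
∣p∪q∣≤∣p∣+∣q∣ []            []            = z≤n
∣p∪q∣≤∣p∣+∣q∣ (inside  ∷ p) (inside  ∷ q) =
  s≤s (≤-trans (∣p∪q∣≤∣p∣+∣q∣ p q) (+-monoʳ-≤ ∣ p ∣ (n≤1+n ∣ q ∣)))
∣p∪q∣≤∣p∣+∣q∣ (inside  ∷ p) (outside ∷ q) = s≤s (∣p∪q∣≤∣p∣+∣q∣ p q)
∣p∪q∣≤∣p∣+∣q∣ (outside ∷ p) (inside  ∷ q) =
  ≤-trans (s≤s (∣p∪q∣≤∣p∣+∣q∣ p q)) (≤-reflexive (sym (+-suc ∣ p ∣ ∣ q ∣)))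
∣p∪q∣≤∣p∣+∣q∣ (outside ∷ p) (outside ∷ q) = ∣p∪q∣≤∣p∣+∣q∣ p q

injection⇒∣p∣≤∣q∣ : ∀ (p : Subset m) (q : Subset m′) (f : Fin m → Fin m′) →
                    (∀ x → x ∈ p → f x ∈ q) →
                    (∀ x y → x ∈ p → y ∈ p → f x ≡ f y → x ≡ y) → ∣ p ∣ ≤ ∣ q ∣
injection⇒∣p∣≤∣q∣ [] q f _ _ = z≤n
injection⇒∣p∣≤∣q∣ (outside ∷ p) q f maps inj =
  injection⇒∣p∣≤∣q∣ p q (f ∘ suc) (λ x → maps (suc x) ∘ there)
    (λ x y x∈ y∈ → sucᶠ-injective ∘ inj (suc x) (suc y) (there x∈) (there y∈))
injection⇒∣p∣≤∣q∣ (inside ∷ p) q f maps inj = begin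
  suc ∣ p ∣                      ≤⟨ s≤s (injection⇒∣p∣≤∣q∣ p (q [ f zero ]≔ outside) (f ∘ suc) maps′ inj′) ⟩
  suc ∣ q [ f zero ]≔ outside ∣  ≡⟨ ∣p∣≡1+∣p-x∣ q (maps zero here) ⟨
  ∣ q ∣                          ∎
  where
  open ≤-Reasoning
  inj′ : ∀ x y → x ∈ p → y ∈ p → f (suc x) ≡ f (suc y) → x ≡ y
  inj′ x y x∈ y∈ = sucᶠ-injective ∘ inj (suc x) (suc y) (there x∈) (there y∈)
  maps′ : ∀ x → x ∈ p → f (suc x) ∈ q [ f zero ]≔ outside
  maps′ x x∈ = []≔-minimal q _ _ (λ e → 0ᶠ≢1+n (inj zero (suc x) here (there x∈) (sym e)))
                 (maps (suc x) (there x∈))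

⋃ : Subset m → (Fin m → Subset m′) → Subset m′
⋃ []            f = ∅
⋃ (inside  ∷ p) f = f zero ∪ ⋃ p (f ∘ suc)
⋃ (outside ∷ p) f = ⋃ p (f ∘ suc)

∈-⋃ : ∀ (p : Subset m) (f : Fin m → Subset m′) {x y} → x ∈ p → y ∈ f x → y ∈ ⋃ p f
∈-⋃ (inside  ∷ p) f {zero}  here        y∈ = x∈p∪q⁺ (inj₁ y∈)
∈-⋃ (inside  ∷ p) f {suc x} (there x∈p) y∈ = x∈p∪q⁺ (inj₂ (∈-⋃ p (f ∘ suc) x∈p y∈))
∈-⋃ (outside ∷ p) f {suc x} (there x∈p) y∈ = ∈-⋃ p (f ∘ suc) x∈p y∈

∣⋃∣≤∣p∣*K : ∀ (p : Subset m) (f : Fin m → Subset m′) K →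
            (∀ x → x ∈ p → ∣ f x ∣ ≤ K) → ∣ ⋃ p f ∣ ≤ ∣ p ∣ * K
∣⋃∣≤∣p∣*K {m′ = m′} [] f K _ = ≤-reflexive (∣⊥∣≡0 m′)
∣⋃∣≤∣p∣*K (inside ∷ p) f K bounded =
  ≤-trans (∣p∪q∣≤∣p∣+∣q∣ (f zero) _)
    (+-mono-≤ (bounded zero here) (∣⋃∣≤∣p∣*K p (f ∘ suc) K (λ x → bounded (suc x) ∘ there)))
∣⋃∣≤∣p∣*K (outside ∷ p) f K bounded = ∣⋃∣≤∣p∣*K p (f ∘ suc) K (λ x → bounded (suc x) ∘ there)

-- Rooted trees

module RootedTree (T : Graph) (tree : IsTree T) (root : Fin (n T)) where

  Node : Set
  Node = Fin (n T)

  RootWalk : ℕ → Node → Set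
  RootWalk zero    t = t ≡ root
  RootWalk (suc k) t = ∃[ s ] (Adj T t s × RootWalk k s)

  rootWalk? : ∀ k t → Dec (RootWalk k t)
  rootWalk? zero    t = t ≟ᶠ root
  rootWalk? (suc k) t = any? λ s → dec T t s ×-dec rootWalk? k s

  walk⇒RootWalk : ∀ {P t u} → WalkIn T P t u → u ≡ root → ∃[ k ] RootWalk k t
  walk⇒RootWalk (here _)       u≡root = 0 , u≡root
  walk⇒RootWalk (step _ t~s w) u≡root =
    let k , w′ = walk⇒RootWalk w u≡root in suc k , _ , t~s , w′

  shortestRootWalk : ∀ t → Σ ℕ λ d → RootWalk d t × (∀ k → k < d → ¬ RootWalk k t)
  shortestRootWalk t =
    let k , w = walk⇒RootWalk (proj₁ tree t root) refl
    in leastWitness (λ k → RootWalk k t) (λ k → rootWalk? k t) k w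

  depth : Node → ℕ
  depth t = proj₁ (shortestRootWalk t)

  depth-walk : ∀ t → RootWalk (depth t) t
  depth-walk t = proj₁ (proj₂ (shortestRootWalk t))

  depth-minimal : ∀ t k → RootWalk k t → depth t ≤ k
  depth-minimal t k w = ≮⇒≥ λ k<d → proj₂ (proj₂ (shortestRootWalk t)) k k<d w

  depth≡0⇒root : ∀ {t} → depth t ≡ 0 → t ≡ root
  depth≡0⇒root {t} d≡0 = subst (λ k → RootWalk k t) d≡0 (depth-walk t)

  firstStep : ∀ {k t} → RootWalk k t → Node
  firstStep {zero}  {t} _       = t
  firstStep {suc k}     (s , _) = s

  parent : Node → Node
  parent t = firstStep (depth-walk t)

  depth-firstStep : ∀ {k t} (w : RootWalk k t) → depth t ≡ k → depth (firstStep w) ≡ pred k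
  depth-firstStep {zero}      _              d≡0   = d≡0
  depth-firstStep {suc k} {t} (s , t~s , w) d≡1+k =
    ≤-antisym (depth-minimal s k w)
      (≤-pred (subst (_≤ suc (depth s)) d≡1+k (depth-minimal t _ (s , t~s , depth-walk s))))

  depth-parent : ∀ t → depth (parent t) ≡ pred (depth t)
  depth-parent t = depth-firstStep (depth-walk t) refl

  parent-edge : ∀ t → 0 < depth t → Adj T t (parent t)
  parent-edge t 0<d with depth t | depth-walk t
  ... | suc _ | _ , t~s , _ = t~s

  _IsChildOf_ : Node → Node → Set
  y IsChildOf z = depth y ≡ suc (depth z) × parent y ≡ z

  isChildOf? : ∀ y z → Dec (y IsChildOf z)
  isChildOf? y z = (depth y ≟ suc (depth z)) ×-dec (parent y ≟ᶠ z)

  child-of-parent : ∀ t → 0 < depth t → t IsChildOf parent t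
  child-of-parent t 0<d =
    sym (trans (cong suc (depth-parent t)) (suc-pred (depth t) {{>-nonZero 0<d}})) , refl

  ancestor : ℕ → Node → Node
  ancestor zero    t = t
  ancestor (suc i) t = parent (ancestor i t)

  depth-ancestor : ∀ i t → depth (ancestor i t) ≡ depth t ∸ i
  depth-ancestor zero    t = refl
  depth-ancestor (suc i) t = begin
    depth (parent (ancestor i t))  ≡⟨ depth-parent (ancestor i t) ⟩
    pred (depth (ancestor i t))    ≡⟨ cong pred (depth-ancestor i t) ⟩
    pred (depth t ∸ i)             ≡⟨ pred[m∸n]≡m∸[1+n] (depth t) i ⟩
    depth t ∸ suc i                ∎
    where open ≡-Reasoning

  ancestor-depth : ∀ t → ancestor (depth t) t ≡ root
  ancestor-depth t = depth≡0⇒root (trans (depth-ancestor (depth t) t) (n∸n≡0 (depth t)))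

  ancestor-parent : ∀ i t → ancestor i (parent t) ≡ ancestor (suc i) t
  ancestor-parent zero    t = refl
  ancestor-parent (suc i) t = cong parent (ancestor-parent i t)

  ancestor-edge : ∀ {i t} → i < depth t → Adj T (ancestor i t) (ancestor (suc i) t)
  ancestor-edge {i} {t} i<d =
    parent-edge (ancestor i t) (subst (0 <_) (sym (depth-ancestor i t)) (m<n⇒0<n∸m i<d))

  ancestor-injective : ∀ {i j t} → i ≤ depth t → j ≤ depth t → ancestor i t ≡ ancestor j t → i ≡ j
  ancestor-injective {i} {j} {t} i≤d j≤d eq =
    ∸-cancelˡ-≡ i≤d j≤d (trans (sym (depth-ancestor i t)) (trans (cong depth eq) (depth-ancestor j t)))

  _≼_ : Node → Node → Set
  x ≼ y = ancestor (depth y ∸ depth x) y ≡ x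

  _≼?_ : ∀ x y → Dec (x ≼ y)
  x ≼? y = ancestor (depth y ∸ depth x) y ≟ᶠ x

  ≼-intro : ∀ {i x y} → i ≤ depth y → ancestor i y ≡ x → x ≼ y
  ≼-intro {i} {x} {y} i≤d eq = trans (cong (λ j → ancestor j y) gap≡i) eq
    where
    gap≡i : depth y ∸ depth x ≡ i
    gap≡i = trans (cong (depth y ∸_) (trans (cong depth (sym eq)) (depth-ancestor i y))) (m∸[m∸n]≡n i≤d)

  ≼-refl : ∀ x → x ≼ x
  ≼-refl x = ≼-intro z≤n refl

  root-≼ : ∀ y → root ≼ y
  root-≼ y = ≼-intro ≤-refl (ancestor-depth y)

  ≼-depth : ∀ {x y} → x ≼ y → depth x ≤ depth y
  ≼-depth {x} {y} x≼y =
    subst (_≤ depth y) (trans (sym (depth-ancestor gap y)) (cong depth x≼y)) (m∸n≤m (depth y) gap)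
    where gap = depth y ∸ depth x

  ≼-depth-≡ : ∀ {x y} → x ≼ y → depth x ≡ depth y → x ≡ y
  ≼-depth-≡ {x} {y} x≼y dx≡dy =
    trans (sym x≼y) (cong (λ j → ancestor j y) (trans (cong (depth y ∸_) dx≡dy) (n∸n≡0 (depth y))))

  ¬≼⇒0<depth : ∀ {x y} → ¬ x ≼ y → 0 < depth x
  ¬≼⇒0<depth {x} {y} x⋠y = n≢0⇒n>0 λ d≡0 → x⋠y (subst (_≼ y) (sym (depth≡0⇒root d≡0)) (root-≼ y))

  ≼-parent : ∀ {x y} → x ≼ y → y ≢ x → x ≼ parent y
  ≼-parent {x} {y} x≼y y≢x = go (depth y ∸ depth x) (m∸n≤m (depth y) (depth x)) x≼y
    where
    go : ∀ i → i ≤ depth y → ancestor i y ≡ x → x ≼ parent y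
    go zero    _     y≡x = ⊥-elim (y≢x y≡x)
    go (suc i) 1+i≤d eq  =
      ≼-intro (subst (i ≤_) (sym (depth-parent y)) (pred-mono-≤ 1+i≤d)) (trans (ancestor-parent i y) eq)

  ≼-child : ∀ {x y y′} → y′ IsChildOf y → x ≼ y → x ≼ y′
  ≼-child {x} {y} {y′} (d≡1+d , parent≡y) x≼y =
    ≼-intro (subst (suc (depth y ∸ depth x) ≤_) (sym d≡1+d) (s≤s (m∸n≤m (depth y) (depth x))))
      (trans (sym (ancestor-parent gap y′)) (trans (cong (ancestor gap) parent≡y) x≼y))
    where gap = depth y ∸ depth x

  -- The paths from y and z up to their lowest common ancestor close a cycle with the edge y z.
  module NonTreeEdge {y z : Node} (y~z : Adj T y z) (y≭z : ¬ y IsChildOf z) (z≭y : ¬ z IsChildOf y) where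

    meets-at-root : ancestor (depth y) y ≼ z
    meets-at-root = subst (_≼ z) (sym (ancestor-depth y)) (root-≼ z)

    meet : Σ ℕ λ a → ancestor a y ≼ z × (∀ i → i < a → ¬ ancestor i y ≼ z)
    meet = leastWitness (λ i → ancestor i y ≼ z) (λ i → ancestor i y ≼? z) (depth y) meets-at-root

    a : ℕ
    a = proj₁ meet

    a-least : ∀ i → i < a → ¬ ancestor i y ≼ z
    a-least = proj₂ (proj₂ meet)

    a≤depth : a ≤ depth y
    a≤depth = ≮⇒≥ λ d<a → a-least (depth y) d<a meets-at-root

    b : ℕ
    b = depth z ∸ depth (ancestor a y)

    b≤depth : b ≤ depth z
    b≤depth = m∸n≤m (depth z) (depth (ancestor a y))

    meets : ancestor b z ≡ ancestor a y
    meets = proj₁ (proj₂ meet)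

    -- vertex 0, …, vertex a climbs from y to the common ancestor,
    -- vertex a, …, vertex (a + b) descends from it to z
    vertex : ℕ → Node
    vertex i with i ≤? a
    ... | yes _ = ancestor i y
    ... | no  _ = ancestor (a + b ∸ i) z

    vertex-left : ∀ {i} → i ≤ a → vertex i ≡ ancestor i y
    vertex-left {i} i≤a with i ≤? a
    ... | yes _   = refl
    ... | no  i≰a = ⊥-elim (i≰a i≤a)

    vertex-right : ∀ q → vertex (a + q) ≡ ancestor (b ∸ q) z
    vertex-right q with a + q ≤? a
    vertex-right zero    | yes _ = trans (cong (λ i → ancestor i y) (+-identityʳ a)) (sym meets)
    vertex-right (suc q) | yes a+1+q≤a = ⊥-elim (m+1+n≰m a a+1+q≤a)
    ... | no _ = cong (λ i → ancestor i z) ([m+n]∸[m+o]≡n∸o a b q)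

    data Side : ℕ → Set where
      left  : ∀ {i} → i ≤ a → Side i
      right : ∀ {q} → 0 < q → q ≤ b → Side (a + q)

    side : ∀ {i} → i ≤ a + b → Side i
    side {i} i≤a+b with i ≤? a
    ... | yes i≤a = left i≤a
    ... | no  i≰a = subst Side (m+[n∸m]≡n (<⇒≤ a<i))
                      (right (m<n⇒0<n∸m a<i) (subst (i ∸ a ≤_) (m+n∸m≡n a b) (∸-monoˡ-≤ a i≤a+b)))
      where a<i = ≰⇒> i≰a

    crossing : ∀ {i q} → i ≤ a → 0 < q → q ≤ b → ancestor i y ≢ ancestor (b ∸ q) z
    crossing {i} {q} i≤a 0<q q≤b eq with m≤n⇒m<n∨m≡n i≤a
    ... | inj₁ i<a  = a-least i i<a (≼-intro (≤-trans (m∸n≤m b q) b≤depth) (sym eq))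
    ... | inj₂ refl = <-irrefl (sym b≡b∸q) (∸-monoʳ-< 0<q q≤b)
      where
      b≡b∸q : b ≡ b ∸ q
      b≡b∸q = ancestor-injective b≤depth (≤-trans (m∸n≤m b q) b≤depth) (trans meets eq)

    vertex-injective : ∀ {i j} → Side i → Side j → vertex i ≡ vertex j → i ≡ j
    vertex-injective (left i≤a) (left j≤a) eq =
      ancestor-injective (≤-trans i≤a a≤depth) (≤-trans j≤a a≤depth)
        (trans (sym (vertex-left i≤a)) (trans eq (vertex-left j≤a)))
    vertex-injective (left i≤a) (right {q} 0<q q≤b) eq =
      ⊥-elim (crossing i≤a 0<q q≤b (trans (sym (vertex-left i≤a)) (trans eq (vertex-right q))))
    vertex-injective (right {q} 0<q q≤b) (left j≤a) eq =
      ⊥-elim (crossing j≤a 0<q q≤b (trans (sym (vertex-left j≤a)) (trans (sym eq) (vertex-right q))))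
    vertex-injective (right {q} _ q≤b) (right {q′} _ q′≤b) eq =
      cong (a +_) (∸-cancelˡ-≡ q≤b q′≤b
        (ancestor-injective (≤-trans (m∸n≤m b q) b≤depth) (≤-trans (m∸n≤m b q′) b≤depth)
          (trans (sym (vertex-right q)) (trans eq (vertex-right q′)))))

    vertex-edge : ∀ i → i < a + b → Adj T (vertex i) (vertex (suc i))
    vertex-edge i i<a+b = by-side (suc i ≤? a)
      where
      up : suc i ≤ a → Adj T (vertex i) (vertex (suc i))
      up i<a = subst₂ (Adj T) (sym (vertex-left (<⇒≤ i<a))) (sym (vertex-left i<a))
                 (ancestor-edge (≤-trans i<a a≤depth))
      down : ∀ q → q < b → Adj T (vertex (a + q)) (vertex (suc (a + q)))
      down q q<b = subst₂ (Adj T)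
        (sym (trans (vertex-right q) (cong (λ j → ancestor j z) (+-∸-assoc 1 q<b))))
        (sym (trans (cong vertex (sym (+-suc a q))) (vertex-right (suc q))))
        (Graph.sym T (ancestor-edge (≤-trans (∸-monoʳ-< z<s q<b) b≤depth)))
      by-side : Dec (suc i ≤ a) → Adj T (vertex i) (vertex (suc i))
      by-side (yes i<a) = up i<a
      by-side (no  i≮a) =
        subst (λ j → Adj T (vertex j) (vertex (suc j))) (m+[n∸m]≡n a≤i)
          (down (i ∸ a) (+-cancelˡ-< a _ b (subst (_< a + b) (sym (m+[n∸m]≡n a≤i)) i<a+b)))
        where a≤i = ≤-pred (≰⇒> i≮a)

    closing-edge : Adj T (vertex (a + b)) (vertex 0)
    closing-edge = subst₂ (Adj T)
      (sym (trans (vertex-right b) (cong (λ j → ancestor j z) (n∸n≡0 b)))) (sym (vertex-left z≤n))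
      (Graph.sym T y~z)

    2≤i+j : ∀ i j → ancestor j z ≡ ancestor i y → i ≤ depth y → j ≤ depth z → 2 ≤ i + j
    2≤i+j 0 0 z≡y _ _ = ⊥-elim (irrefl T (subst (Adj T y) z≡y y~z))
    2≤i+j 1 0 z≡py 1≤d _ = ⊥-elim (y≭z (subst (y IsChildOf_) (sym z≡py) (child-of-parent y 1≤d)))
    2≤i+j 0 1 pz≡y _ 1≤d = ⊥-elim (z≭y (subst (z IsChildOf_) pz≡y (child-of-parent z 1≤d)))
    2≤i+j 0 (suc (suc j)) _ _ _ = s≤s (s≤s z≤n)
    2≤i+j 1 (suc j)       _ _ _ = s≤s (s≤s z≤n)
    2≤i+j (suc (suc i)) j _ _ _ = s≤s (s≤s z≤n)

    cycle : Cycle T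
    cycle = record
      { len   = suc (a + b)
      ; len≥3 = s≤s (2≤i+j a b meets a≤depth b≤depth)
      ; vert  = vertex ∘ toℕ
      ; inj   = λ {i} {j} eq → toℕ-injective (vertex-injective (side′ i) (side′ j) eq)
      ; edges = consecutive-adjacent
      }
      where
      side′ : (i : Fin (suc (a + b))) → Side (toℕ i)
      side′ i = side (≤-pred (toℕ<n i))
      consecutive-adjacent : ∀ i j → CycNext (suc (a + b)) i j → Adj T (vertex (toℕ i)) (vertex (toℕ j))
      consecutive-adjacent i j (inj₁ 1+i≡j) = subst (λ k → Adj T (vertex (toℕ i)) (vertex k)) 1+i≡j
        (vertex-edge (toℕ i) (≤-pred (subst (_< suc (a + b)) (sym 1+i≡j) (toℕ<n j))))
      consecutive-adjacent i j (inj₂ (1+i≡len , j≡0)) =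
        subst₂ (λ k l → Adj T (vertex k) (vertex l)) (sym (suc-injective 1+i≡len)) (sym j≡0) closing-edge

  tree-edge : ∀ {y z} → Adj T y z → y IsChildOf z ⊎ z IsChildOf y
  tree-edge {y} {z} y~z with isChildOf? y z | isChildOf? z y
  ... | yes y≺z | _        = inj₁ y≺z
  ... | no  _   | yes z≺y  = inj₂ z≺y
  ... | no  y≭z | no  z≭y  = ⊥-elim (proj₂ tree (NonTreeEdge.cycle y~z y≭z z≭y))

  walk-source : ∀ {P t u} → WalkIn T P t u → P t
  walk-source (here p)     = p
  walk-source (step p _ _) = p

  walk-leaving-subtree : ∀ {P} x {y z} → WalkIn T P y z → x ≼ y → ¬ x ≼ z → P x × P (parent x)
  walk-leaving-subtree x (here _) x≼y x⋠y = ⊥-elim (x⋠y x≼y)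
  walk-leaving-subtree {P} x {y} (step Py y~s w) x≼y x⋠z with x ≼? _
  ... | yes x≼s = walk-leaving-subtree x w x≼s x⋠z
  ... | no  x⋠s with tree-edge y~s
  ...   | inj₂ s≺y        = ⊥-elim (x⋠s (≼-child s≺y x≼y))
  ...   | inj₁ (_ , py≡s) with y ≟ᶠ x
  ...     | yes refl = Py , subst P (sym py≡s) (walk-source w)
  ...     | no  y≢x  = ⊥-elim (x⋠s (subst (x ≼_) py≡s (≼-parent x≼y y≢x)))

  module Highest (S : Node → Set) (S? : ∀ t → Dec (S t)) (inhabited : ∃[ t ] S t)
                 (connected : ∀ t t′ → S t → S t′ → WalkIn T S t t′) where

    OccursAtDepth : ℕ → Set
    OccursAtDepth d = ∃[ t ] (S t × depth t ≡ d)

    shallowest : Σ ℕ λ d → OccursAtDepth d × (∀ d′ → d′ < d → ¬ OccursAtDepth d′)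
    shallowest = leastWitness OccursAtDepth (λ d → any? λ t → S? t ×-dec (depth t ≟ d))
                   (depth (proj₁ inhabited)) (proj₁ inhabited , proj₂ inhabited , refl)

    top : Node
    top = proj₁ (proj₁ (proj₂ shallowest))

    top-∈ : S top
    top-∈ = proj₁ (proj₂ (proj₁ (proj₂ shallowest)))

    top-highest : ∀ t → S t → depth top ≤ depth t
    top-highest t St = subst (_≤ depth t) (sym (proj₂ (proj₂ (proj₁ (proj₂ shallowest)))))
                         (≮⇒≥ λ d<d₀ → proj₂ (proj₂ shallowest) (depth t) d<d₀ (t , St , refl))

    top-≼ : ∀ t → S t → top ≼ t
    top-≼ t St with top ≼? t
    ... | yes top≼t = top≼t
    ... | no  top⋠t = ⊥-elim (n≮n (depth (parent top))
                          (subst (_≤ depth (parent top)) (proj₁ (child-of-parent top (¬≼⇒0<depth top⋠t)))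
                            (top-highest (parent top) S-parent)))
      where S-parent = proj₂ (walk-leaving-subtree top (connected top t top-∈ St) (≼-refl top) top⋠t)

    below-top : ∀ {t} → S t → t ≢ top → ¬ t ≼ top
    below-top {t} St t≢top t≼top = t≢top (≼-depth-≡ t≼top (≤-antisym (≼-depth t≼top) (top-highest t St)))

    parent-∈ : ∀ {t} → S t → t ≢ top → S (parent t)
    parent-∈ {t} St t≢top =
      proj₂ (walk-leaving-subtree t (connected t top St top-∈) (≼-refl t) (below-top St t≢top))

-- Sliding tokens in a clique tree

bound-arithmetic : ∀ ω k → 0 < k → k * suc ω + 1 ≤ (3 * ω + 3) * k * k
bound-arithmetic ω (suc k) _ = begin
  K + 1                        ≤⟨ +-monoʳ-≤ K (s≤s z≤n) ⟩
  K + K                        ≤⟨ m≤m+n (K + K) K ⟩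
  K + K + K                    ≡⟨ K+K+K≡[3ω+3][1+k] ω k ⟩
  (3 * ω + 3) * suc k          ≤⟨ m≤m*n _ (suc k) ⟩
  (3 * ω + 3) * suc k * suc k  ∎
  where
  open ≤-Reasoning
  K = suc k * suc ω
  K+K+K≡[3ω+3][1+k] : ∀ ω k → suc k * suc ω + suc k * suc ω + suc k * suc ω ≡ (3 * ω + 3) * suc k
  K+K+K≡[3ω+3][1+k] = solve 2 (λ w k → let K = (con 1 :+ k) :* (con 1 :+ w) in
                             K :+ K :+ K := (con 3 :* w :+ con 3) :* (con 1 :+ k)) refl
    where open import Data.Nat.Solver using (module +-*-Solver); open +-*-Solver

module CliqueTree (G : Graph) (D : TreeDecomposition G) (cliqueTree : IsCliqueTree D) (v₀ : Fin (n G)) where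

  open RootedTree (T D) (isTree D) (proj₁ (cover D v₀))

  Vertex : Set
  Vertex = Fin (n G)

  module Bags (x : Vertex) = Highest (λ t → x ∈ bag D t) (λ t → x ∈? bag D t) (cover D x) (subtree D x)

  top : Vertex → Node
  top = Bags.top

  adjacent-in-bag : ∀ {t u v} → u ∈ bag D t → v ∈ bag D t → u ≢ v → Adj G u v
  adjacent-in-bag = proj₂ cliqueTree _ _ _

  -- v₀ is a junk value at the root, whose bag has no parent bag
  introduced-spec : ∀ c → Σ Vertex λ w → (0 < depth c → w ∈ bag D c × w ∉ bag D (parent c))
  introduced-spec c with any? (λ w → (w ∈? bag D c) ×-dec ¬? (w ∈? bag D (parent c)))
  ... | yes (w , w∈c , w∉pc) = w , λ _ → w∈c , w∉pc
  ... | no  none             = v₀ , λ 0<d → ⊥-elim (proj₁ cliqueTree c (parent c) (parent-edge c 0<d) c⊆pc)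
    where
    c⊆pc : bag D c ⊆ bag D (parent c)
    c⊆pc {x} x∈c with x ∈? bag D (parent c)
    ... | yes x∈pc = x∈pc
    ... | no  x∉pc = ⊥-elim (none (x , x∈c , x∉pc))

  introduced : Node → Vertex
  introduced c = proj₁ (introduced-spec c)

  introduced-∈ : ∀ {c} → 0 < depth c → introduced c ∈ bag D c
  introduced-∈ {c} 0<d = proj₁ (proj₂ (introduced-spec c) 0<d)

  introduced-∉ : ∀ {c} → 0 < depth c → introduced c ∉ bag D (parent c)
  introduced-∉ {c} 0<d = proj₂ (proj₂ (introduced-spec c) 0<d)

  top-introduced : ∀ {c} → 0 < depth c → top (introduced c) ≡ c
  top-introduced {c} 0<d with c ≟ᶠ top (introduced c)
  ... | yes c≡top = sym c≡top
  ... | no  c≢top = ⊥-elim (introduced-∉ 0<d (Bags.parent-∈ (introduced c) (introduced-∈ 0<d) c≢top))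

  module BelowTop {v c} (v∈c : v ∈ bag D c) (c≢top : c ≢ top v) where

    0<depth : 0 < depth c
    0<depth = ¬≼⇒0<depth (Bags.below-top v v∈c c≢top)

    w : Vertex
    w = introduced c

    w∈c : w ∈ bag D c
    w∈c = introduced-∈ 0<depth

    v∈parent : v ∈ bag D (parent c)
    v∈parent = Bags.parent-∈ v v∈c c≢top

    w≢v : w ≢ v
    w≢v w≡v = introduced-∉ 0<depth (subst (_∈ bag D (parent c)) (sym w≡v) v∈parent)

    v~w : Adj G v w
    v~w = adjacent-in-bag v∈c w∈c (w≢v ∘ sym)

    top-deepens : depth (top v) < depth (top w)
    top-deepens = begin-strict
      depth (top v)     ≤⟨ Bags.top-highest v (parent c) v∈parent ⟩
      depth (parent c)  <⟨ ≤-reflexive (sym (proj₁ (child-of-parent c 0<depth))) ⟩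
      depth c           ≡⟨ cong depth (top-introduced 0<depth) ⟨
      depth (top w)     ∎
      where open ≤-Reasoning

  module _ {I : Subset (n G)} (independent : Independent G I) where

    apart : ∀ {t u v} → u ∈ I → v ∈ I → u ≢ v → u ∈ bag D t → v ∈ bag D t → ⊥
    apart u∈I v∈I u≢v u∈t v∈t = independent _ _ u∈I v∈I (adjacent-in-bag u∈t v∈t u≢v)

    -- the edge w u lies in a bag e below both c = top w and top u; as u ∉ bag c,
    -- top u lies strictly between c and e, so w's subtree passes through top u and its parent
    blocker-above : ∀ {u v c} → u ∈ I → v ∈ I → u ≢ v → (v∈c : v ∈ bag D c) (c≢top : c ≢ top v) →
                    Adj G (introduced c) u → introduced c ∈ bag D (parent (top u))
    blocker-above {u} {v} {c} u∈I v∈I u≢v v∈c c≢top w~u =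
      let e , w∈e , u∈e = edgeCov D w u w~u in from-edge-bag e w∈e u∈e
      where
      open BelowTop v∈c c≢top
      u∉c : u ∉ bag D c
      u∉c u∈c = apart u∈I v∈I u≢v u∈c v∈c
      c≼ : ∀ {e} → w ∈ bag D e → c ≼ e
      c≼ w∈e = subst (_≼ _) (top-introduced 0<depth) (Bags.top-≼ w _ w∈e)
      from-edge-bag : ∀ e → w ∈ bag D e → u ∈ bag D e → w ∈ bag D (parent (top u))
      from-edge-bag e w∈e u∈e with c ≼? top u | top u ≟ᶠ c
      ... | no c⋠tu | _ =
        ⊥-elim (u∉c (proj₁ (walk-leaving-subtree c (subtree D u e (top u) u∈e (Bags.top-∈ u))
                                                   (c≼ w∈e) c⋠tu)))
      ... | yes _    | yes tu≡c = ⊥-elim (u∉c (subst (λ t → u ∈ bag D t) tu≡c (Bags.top-∈ u)))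
      ... | yes c≼tu | no  tu≢c =
        proj₂ (walk-leaving-subtree (top u) (subtree D w e c w∈e w∈c) (Bags.top-≼ u e u∈e) tu⋠c)
        where
        tu⋠c : ¬ top u ≼ c
        tu⋠c tu≼c = tu≢c (≼-depth-≡ tu≼c (≤-antisym (≼-depth tu≼c) (≼-depth c≼tu)))

  Blocked : Subset (n G) → Vertex → Node → Set
  Blocked I v c = ∃[ u ] (u ∈ I × u ≢ v × Adj G (introduced c) u)

  blocked? : ∀ I v c → Dec (Blocked I v c)
  blocked? I v c = any? λ u → (u ∈? I) ×-dec (¬? (u ≟ᶠ v) ×-dec dec G (introduced c) u)

  Stuck : Subset (n G) → Set
  Stuck I = ∀ {v c} → v ∈ I → v ∈ bag D c → c ≢ top v → Blocked I v c

  Move : Subset (n G) → Set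
  Move I = ∃[ v ] ∃[ c ] (v ∈ I × v ∈ bag D c × c ≢ top v × ¬ Blocked I v c)

  move? : ∀ I → Dec (Move I)
  move? I = any? λ v → any? λ c →
    (v ∈? I) ×-dec ((v ∈? bag D c) ×-dec (¬? (c ≟ᶠ top v) ×-dec ¬? (blocked? I v c)))

  potential : Subset (n G) → ℕ
  potential I = sumOver I λ y → max depth ∸ depth (top y)

  module Step {I} (independent : Independent G I) {v c} (v∈I : v ∈ I) (v∈c : v ∈ bag D c)
              (c≢top : c ≢ top v) (free : ¬ Blocked I v c) where
    open BelowTop v∈c c≢top

    I-v : Subset (n G)
    I-v = I [ v ]≔ outside

    J : Subset (n G)
    J = I-v [ w ]≔ inside

    w∉I : w ∉ I
    w∉I w∈I = independent v w v∈I w∈I v~w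

    w∉I-v : w ∉ I-v
    w∉I-v = w∉I ∘ ∈-[]≔⁻ I outside w≢v

    ∈J⁻ : ∀ {y} → y ∈ J → y ≡ w ⊎ (y ∈ I × y ≢ v)
    ∈J⁻ {y} y∈J with y ≟ᶠ w | y ≟ᶠ v
    ... | yes y≡w | _        = inj₁ y≡w
    ... | no  _   | yes refl = ⊥-elim (∉-[]≔outside I v (∈-[]≔⁻ I-v inside (w≢v ∘ sym) y∈J))
    ... | no  y≢w | no  y≢v  = inj₂ (∈-[]≔⁻ I outside y≢v (∈-[]≔⁻ I-v inside y≢w y∈J) , y≢v)

    J-independent : Independent G J
    J-independent y y′ y∈J y′∈J with ∈J⁻ y∈J | ∈J⁻ y′∈J
    ... | inj₁ refl        | inj₁ refl          = irrefl G
    ... | inj₁ refl        | inj₂ (y′∈I , y′≢v) = λ w~y′ → free (y′ , y′∈I , y′≢v , w~y′)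
    ... | inj₂ (y∈I , y≢v) | inj₁ refl          = λ y~w → free (y , y∈I , y≢v , Graph.sym G y~w)
    ... | inj₂ (y∈I , _)   | inj₂ (y′∈I , _)    = independent y y′ y∈I y′∈I

    slide : Slide G I J
    slide = v , w , v~w , v∈I , w∉I , refl

    ∣J∣≡∣I∣ : ∣ J ∣ ≡ ∣ I ∣
    ∣J∣≡∣I∣ = trans (∣p+x∣≡1+∣p∣ I-v w∉I-v) (sym (∣p∣≡1+∣p-x∣ I v∈I))

    potential-decreases : potential J < potential I
    potential-decreases = begin-strict
      potential J                ≡⟨ sumOver-insert I-v height w∉I-v ⟩
      height w + potential I-v   <⟨ +-monoˡ-< (potential I-v) (∸-monoʳ-< top-deepens (≤-max depth (top w))) ⟩
      height v + potential I-v   ≡⟨ +-comm (height v) _ ⟩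
      potential I-v + height v   ≡⟨ sumOver-remove I height v∈I ⟩
      potential I                ∎
      where
      open ≤-Reasoning
      height : Vertex → ℕ
      height y = max depth ∸ depth (top y)

  slide-until-stuck : ∀ {I} → Independent G I → Acc _<_ (potential I) →
                      ∃[ J ] (Independent G J × TokenSliding G I J × ∣ J ∣ ≡ ∣ I ∣ × Stuck J)
  slide-until-stuck {I} independent (acc smaller) with move? I
  ... | yes (v , c , v∈I , v∈c , c≢top , free) =
    let open Step independent v∈I v∈c c≢top free
        K , K-independent , J↝K , ∣K∣≡∣J∣ , K-stuck =
          slide-until-stuck J-independent (smaller potential-decreases)
    in K , K-independent , move slide J-independent J↝K , trans ∣K∣≡∣J∣ ∣J∣≡∣I∣ , K-stuck
  ... | no  no-move = I , independent , done , refl , stuck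
    where
    stuck : Stuck I
    stuck {v} {c} v∈I v∈c c≢top =
      decidable-stable (blocked? I v c) λ free → no-move (v , c , v∈I , v∈c , c≢top , free)

  ∈-bagsOf⁻ : ∀ {v c} → c ∈ bagsOf D v → v ∈ bag D c
  ∈-bagsOf⁻ {v} {c} c∈ =
    lookup⇒[]= v (bag D c) (trans (sym (lookup∘tabulate (λ t → lookup (bag D t) v) c)) ([]=⇒lookup c∈))

  -- c ↦ introduced c injects the bags of v other than top v into the parent bags of the tops of I
  module Labels {I} (independent : Independent G I) (stuck : Stuck I) {v} (v∈I : v ∈ I) where

    parentBagOfTop : Vertex → Subset (n G)
    parentBagOfTop u = bag D (parent (top u))

    U : Subset (n G)
    U = ⋃ I parentBagOfTop

    labelBy : ∀ c → Dec (c ≡ top v) → Vertex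
    labelBy c (yes _) = v
    labelBy c (no  _) = introduced c

    label : Node → Vertex
    label c = labelBy c (c ≟ᶠ top v)

    label-∈ : ∀ {c} → v ∈ bag D c → (c≟top : Dec (c ≡ top v)) → labelBy c c≟top ∈ U ∪ ⁅ v ⁆
    label-∈ v∈c (yes _) = x∈p∪q⁺ (inj₂ (x∈⁅x⁆ v))
    label-∈ v∈c (no c≢top) =
      let u , u∈I , u≢v , w~u = stuck v∈I v∈c c≢top
      in x∈p∪q⁺ (inj₁ (∈-⋃ I parentBagOfTop u∈I
                         (blocker-above independent u∈I v∈I u≢v v∈c c≢top w~u)))

    label-injective : ∀ {c c′} → v ∈ bag D c → v ∈ bag D c′ →
                      (c≟ : Dec (c ≡ top v)) (c′≟ : Dec (c′ ≡ top v)) →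
                      labelBy c c≟ ≡ labelBy c′ c′≟ → c ≡ c′
    label-injective _   _    (yes c≡top) (yes c′≡top) _  = trans c≡top (sym c′≡top)
    label-injective _   v∈c′ (yes _)     (no c′≢top)  eq = ⊥-elim (BelowTop.w≢v v∈c′ c′≢top (sym eq))
    label-injective v∈c _    (no c≢top)  (yes _)      eq = ⊥-elim (BelowTop.w≢v v∈c c≢top eq)
    label-injective v∈c v∈c′ (no c≢top)  (no c′≢top)  eq =
      trans (sym (top-introduced (BelowTop.0<depth v∈c c≢top)))
        (trans (cong top eq) (top-introduced (BelowTop.0<depth v∈c′ c′≢top)))

  stuck-bound : ∀ {I} → Independent G I → Stuck I → ∀ ω → WidthAtMost D ω →
                ∀ {v} → v ∈ I → ∣ bagsOf D v ∣ ≤ ∣ I ∣ * suc ω + 1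
  stuck-bound {I} independent stuck ω width {v} v∈I = begin
    ∣ bagsOf D v ∣     ≤⟨ injection⇒∣p∣≤∣q∣ (bagsOf D v) (U ∪ ⁅ v ⁆) label
                            (λ c c∈ → label-∈ (∈-bagsOf⁻ c∈) (c ≟ᶠ top v))
                            (λ c c′ c∈ c′∈ → label-injective (∈-bagsOf⁻ c∈) (∈-bagsOf⁻ c′∈)
                                               (c ≟ᶠ top v) (c′ ≟ᶠ top v)) ⟩
    ∣ U ∪ ⁅ v ⁆ ∣      ≤⟨ ∣p∪q∣≤∣p∣+∣q∣ U ⁅ v ⁆ ⟩
    ∣ U ∣ + ∣ ⁅ v ⁆ ∣  ≤⟨ +-mono-≤ (∣⋃∣≤∣p∣*K I parentBagOfTop (suc ω) (λ u _ → width (parent (top u))))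
                                    (≤-reflexive (∣⁅x⁆∣≡1 v)) ⟩
    ∣ I ∣ * suc ω + 1  ∎
    where
    open ≤-Reasoning
    open Labels independent stuck v∈I

  slide-to-few-bags : ∀ ω → WidthAtMost D ω → ∀ {I} → Independent G I →
                      ∃[ J ] (Independent G J × TokenSliding G I J ×
                              (∀ v → v ∈ J → ∣ bagsOf D v ∣ ≤ (3 * ω + 3) * ∣ I ∣ * ∣ I ∣))
  slide-to-few-bags ω width {I} independent
    with J , J-independent , I↝J , ∣J∣≡∣I∣ , J-stuck ←
           slide-until-stuck independent (<-wellFounded (potential I))
    = J , J-independent , I↝J , bounded
    where
    bounded : ∀ v → v ∈ J → ∣ bagsOf D v ∣ ≤ (3 * ω + 3) * ∣ I ∣ * ∣ I ∣
    bounded v v∈J = begin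
      ∣ bagsOf D v ∣               ≤⟨ stuck-bound J-independent J-stuck ω width v∈J ⟩
      ∣ J ∣ * suc ω + 1            ≡⟨ cong (λ m → m * suc ω + 1) ∣J∣≡∣I∣ ⟩
      ∣ I ∣ * suc ω + 1            ≤⟨ bound-arithmetic ω ∣ I ∣ 0<∣I∣ ⟩
      (3 * ω + 3) * ∣ I ∣ * ∣ I ∣  ∎
      where
      open ≤-Reasoning
      0<∣I∣ = subst (0 <_) (trans (sym (∣p∣≡1+∣p-x∣ J v∈J)) ∣J∣≡∣I∣) z<s

lemma35 : (G : Graph) → Chordal G → (D : TreeDecomposition G) → IsCliqueTree D →
    (ω : ℕ) → WidthAtMost D ω → (k : ℕ) → (I : Subset (n G)) →
    Independent G I → ∣ I ∣ ≡ k →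
    ∃[ I' ] (Independent G I' × TokenSliding G I I' ×
    (∀ v → v ∈ I' → ∣ bagsOf D v ∣ ≤ (3 * ω + 3) * k * k))
lemma35 G _ D cliqueTree ω width k I independent refl with Fin-inhabited? (n G)
... | no  no-vertex = I , independent , done , λ v _ → ⊥-elim (no-vertex v)
... | yes v₀        = CliqueTree.slide-to-few-bags G D cliqueTree v₀ ω width independent
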